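{- Let $S_0,S_1,S_2$ be positive integers, and define $k_1=\tfrac12S_0-S_1+\tfrac12S_2$, $k_2=\tfrac12S_0-\tfrac12S_2$, $k_3=-\tfrac12S_0+\tfrac12S_2$, $k_4=S_0-S_1$, $k_5=-S_1+S_2$, $k_6=0$, $k=\max\{|k_i|:1\le i\le 6\}$, and $l=\left\lceil\frac{2(k+1)}{\min\{S_1,k_1+S_1\}}\right\rceil$. Let $F[n]=k_1+S_1$ if $\mathbf f[n]=0$ and $F[n]=S_1$ if $\mathbf f[n]=1$ ($n\ge1$), and for $i\ge1$ let \[R(F[i,i+l-1])=\textstyle\sum_{q=1}^{i-1}F[q]+\left[k+1,\ \sum_{q=i}^{i+l}F[q]-(k+1)\right]\] (a real interval). Then $\bigcup_{i\ge1}R(F[i,i+l-1])\supseteq\{n\in\mathbb N:n>k\}$.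
   Context: $\varphi=(1+\sqrt5)/2$, $\alpha=2-\varphi$, and $\mathbf{f}=(\lfloor (n+1)\alpha\rfloor-\lfloor n\alpha\rfloor)_{n\ge1}$ is the Fibonacci word with $n$-th letter $\mathbf f[n]$. For $c\in\mathbb R$ and an interval $A$, $c+A=\{c+a:a\in A\}$; empty sums are $0$. -}

module Defs where

open import Data.Nat using (ℕ; zero; suc; _+_; _*_; _∸_; _≤ᵇ_; _⊔_; _⊓_; _/_)
open import Data.Bool using (Bool; true; false; _∧_; if_then_else_)
open import Data.Integer as ℤ using (ℤ; +_; ∣_∣)

-- ⌊ n α ⌋ for α = 2 - φ = (3 - √5)/2, computed exactly:
-- it is the number of m ∈ {1,…,n} with m ≤ n α, and (since 0 ≤ n α < n)
--   m ≤ n(3 - √5)/2  ⇔  2m ≤ 3n  ∧  5 n² ≤ (3n - 2m)².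
countUpTo : (ℕ → Bool) → ℕ → ℕ
countUpTo p zero = 0
countUpTo p (suc m) = countUpTo p m + (if p (suc m) then 1 else 0)

floorMulα : ℕ → ℕ
floorMulα n = countUpTo (λ m → (2 * m ≤ᵇ 3 * n) ∧ (5 * (n * n) ≤ᵇ (3 * n ∸ 2 * m) * (3 * n ∸ 2 * m))) n

fib : ℕ → ℕ
fib n = floorMulα (suc n) ∸ floorMulα n

-- All quantities below are DOUBLED (to stay integral), parameters S0 S1 S2.
-- 2·k_i as integers
twice-k : ℕ → ℕ → ℕ → ℕ → ℤ
twice-k S0 S1 S2 1 = (+ S0 ℤ.- + (2 * S1)) ℤ.+ + S2
twice-k S0 S1 S2 2 = + S0 ℤ.- + S2
twice-k S0 S1 S2 3 = ℤ.- (+ S0) ℤ.+ + S2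
twice-k S0 S1 S2 4 = + (2 * S0) ℤ.- + (2 * S1)
twice-k S0 S1 S2 5 = ℤ.- (+ (2 * S1)) ℤ.+ + (2 * S2)
twice-k S0 S1 S2 _ = + 0

twice-kmax : ℕ → ℕ → ℕ → ℕ
twice-kmax S0 S1 S2 =
  ∣ twice-k S0 S1 S2 1 ∣ ⊔ ∣ twice-k S0 S1 S2 2 ∣ ⊔ ∣ twice-k S0 S1 S2 3 ∣ ⊔
  ∣ twice-k S0 S1 S2 4 ∣ ⊔ ∣ twice-k S0 S1 S2 5 ∣ ⊔ ∣ twice-k S0 S1 S2 6 ∣

ceilDiv : ℕ → ℕ → ℕ
ceilDiv a zero = 0
ceilDiv a (suc b) = (a + b) / suc b

-- 2·min{S1, k1 + S1} = min{2 S1, S0 + S2}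
twice-min : ℕ → ℕ → ℕ → ℕ
twice-min S0 S1 S2 = (2 * S1) ⊓ (S0 + S2)

-- l = ⌈ 2(k+1) / min{S1,k1+S1} ⌉ = ⌈ 2(2k+2) / (2 min) ⌉
lval : ℕ → ℕ → ℕ → ℕ
lval S0 S1 S2 = ceilDiv (2 * (twice-kmax S0 S1 S2 + 2)) (twice-min S0 S1 S2)

-- 2F[n] = 2(k1 + S1) = S0 + S2 if f[n] = 0, and 2 S1 if f[n] = 1
twice-F : ℕ → ℕ → ℕ → ℕ → ℕ
twice-F S0 S1 S2 n with fib n
... | zero = S0 + S2
... | suc _ = 2 * S1

twice-prefix : ℕ → ℕ → ℕ → ℕ → ℕ
twice-prefix S0 S1 S2 zero = 0
twice-prefix S0 S1 S2 (suc j) = twice-prefix S0 S1 S2 j + twice-F S0 S1 S2 (suc j)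

-- n ∈ R(F[i,i+l-1]) = Σ_{q=1}^{i-1} F[q] + [k+1, Σ_{q=i}^{i+l} F[q] - (k+1)],
-- doubled:  P(i-1) + 2k + 2 ≤ 2n ≤ P(i-1) + (P(i+l) - P(i-1)) - (2k+2),
-- i.e.      P(i-1) + 2k + 2 ≤ 2n  and  2n + 2k + 2 ≤ P(i+l).
InR : ℕ → ℕ → ℕ → ℕ → ℕ → Set
InR S0 S1 S2 i n =
  (twice-prefix S0 S1 S2 (i ∸ 1) + (twice-kmax S0 S1 S2 + 2) Data.Nat.≤ 2 * n) ×'
  (2 * n + (twice-kmax S0 S1 S2 + 2) Data.Nat.≤ twice-prefix S0 S1 S2 (i + lval S0 S1 S2))
  where open import Data.Product renaming (_×_ to _×'_)

module Submission where

-- The covering property holds for the doubled partial sums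
-- P j = 2·Σ_{q≤j} F[q] of ANY sequence whose terms are at least
-- m = 2·min{S1, k1+S1} ≥ 1; the Fibonacci word only decides which of the
-- two admissible values each term takes, so it plays no role here.
-- Write K = 2k + 2.  Given n > k, put N = 2n.
--   * Parity: 2k = 2·max{|S0−S1|, |S2−S1|} is even (every |2k_i| is bounded
--     by |2k_4| ⊔ |2k_5|), so 2k < N already gives P 0 + K = K ≤ N.
--   * Discrete intermediate values: since P j ≥ j the value N lies in some
--     window  P j + K ≤ N < P (j+1) + K.
--   * Growth: P (j+1+l) ≥ P (j+1) + l·m ≥ P (j+1) + 2K because
--     l = ⌈2K/m⌉, hence N + K < P (j+1) + 2K ≤ P (j+1+l).
-- These two inequalities say exactly that n ∈ R(F[i, i+l−1]) for i = j+1.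

open import Defs
open import Data.Nat using (ℕ; zero; suc; _+_; _*_; _⊔_; _/_; _%_; _<_; _≤_; z≤n; s≤s; _≤?_)
open import Data.Nat.Properties
open import Data.Nat.DivMod using (m≡m%n+[m/n]*n; m%n<n)
import Data.Integer as ℤ
import Data.Integer.Properties as ℤ
open import Data.Integer.Tactic.RingSolver using (solve-∀)
open import Data.Product using (Σ; _×_; _,_)
open import Data.Empty using (⊥-elim)
open import Relation.Nullary using (yes; no)
open import Relation.Binary.PropositionalEquality

ceilDiv-* : ∀ a b → 0 < b → a ≤ ceilDiv a b * b
ceilDiv-* a (suc b) _ = +-cancelˡ-≤ b a (q * suc b) (begin
    b + a                      ≡⟨ +-comm b a ⟩
    a + b                      ≡⟨ m≡m%n+[m/n]*n (a + b) (suc b) ⟩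
    (a + b) % suc b + q * suc b ≤⟨ +-monoˡ-≤ (q * suc b) (≤-pred (m%n<n (a + b) (suc b))) ⟩
    b + q * suc b              ∎)
  where
  open ≤-Reasoning
  q = (a + b) / suc b

double-<⇒+2≤ : ∀ d n → 2 * d < 2 * n → 2 * d + 2 ≤ 2 * n
double-<⇒+2≤ d n 2d<2n = begin
    2 * d + 2    ≡⟨ +-comm (2 * d) 2 ⟩
    2 + 2 * d    ≡⟨ *-suc 2 d ⟨
    2 * suc d    ≤⟨ *-monoʳ-≤ 2 (*-cancelˡ-< 2 d n 2d<2n) ⟩
    2 * n        ∎
  where open ≤-Reasoning

crossing : ∀ (g : ℕ → ℕ) N f → g 0 ≤ N → N < g f →
           Σ ℕ λ j → (g j ≤ N) × (N < g (suc j))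
crossing g N zero    lo hi = ⊥-elim (<⇒≱ hi lo)
crossing g N (suc f) lo hi with g f ≤? N
... | yes g[f]≤N = f , g[f]≤N , hi
... | no  g[f]≰N = crossing g N f lo (≰⇒> g[f]≰N)

module Growth (P : ℕ → ℕ) (m : ℕ) (step : ∀ j → P j + m ≤ P (suc j)) where

  grows : ∀ j d → P j + d * m ≤ P (j + d)
  grows j zero = begin
      P j + 0      ≡⟨ +-identityʳ (P j) ⟩
      P j          ≡⟨ cong P (+-identityʳ j) ⟨
      P (j + 0)    ∎
    where open ≤-Reasoning
  grows j (suc d) = begin
      P j + (m + d * m)   ≡⟨ cong (P j +_) (+-comm m (d * m)) ⟩
      P j + (d * m + m)   ≡⟨ +-assoc (P j) (d * m) m ⟨
      (P j + d * m) + m   ≤⟨ +-monoˡ-≤ m (grows j d) ⟩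
      P (j + d) + m       ≤⟨ step (j + d) ⟩
      P (suc (j + d))     ≡⟨ cong P (+-suc j d) ⟨
      P (j + suc d)       ∎
    where open ≤-Reasoning

  unbounded : 1 ≤ m → ∀ d → d ≤ P d
  unbounded 1≤m d = begin
      d           ≡⟨ *-identityʳ d ⟨
      d * 1       ≤⟨ *-monoʳ-≤ d 1≤m ⟩
      d * m       ≤⟨ m≤n+m (d * m) (P 0) ⟩
      P 0 + d * m ≤⟨ grows 0 d ⟩
      P d         ∎
    where open ≤-Reasoning

  window : 1 ≤ m → ∀ K l N → 2 * K ≤ l * m → P 0 + K ≤ N →
           Σ ℕ λ j → (P j + K ≤ N) × (N + K ≤ P (suc j + l))
  window 1≤m K l N 2K≤lm lo with crossing (λ j → P j + K) N (suc N) lo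
                                  (≤-trans (unbounded 1≤m (suc N)) (m≤m+n _ K))
  ... | j , below , above = j , below , (begin
      N + K                 ≤⟨ +-monoˡ-≤ K (<⇒≤ above) ⟩
      P (suc j) + K + K     ≡⟨ +-assoc (P (suc j)) K K ⟩
      P (suc j) + (K + K)   ≡⟨ cong (λ x → P (suc j) + (K + x)) (+-identityʳ K) ⟨
      P (suc j) + 2 * K     ≤⟨ +-monoʳ-≤ (P (suc j)) 2K≤lm ⟩
      P (suc j) + l * m     ≤⟨ grows (suc j) l ⟩
      P (suc j + l)         ∎)
    where open ≤-Reasoning

-- 2k = 2·max{|S0−S1|, |S2−S1|}: each |2k_i| is |2k_4| = 2|S0−S1|,
-- |2k_5| = 2|S2−S1|, or bounded by their mean |S0−S1| + |S2−S1|.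
module Parity (S0 S1 S2 : ℕ) where

  U V : ℕ
  U = ℤ.∣ ℤ.+ S0 ℤ.- ℤ.+ S1 ∣
  V = ℤ.∣ ℤ.+ S2 ℤ.- ℤ.+ S1 ∣

  t : ℕ → ℕ
  t i = ℤ.∣ twice-k S0 S1 S2 i ∣

  t1≤U+V : t 1 ≤ U + V
  t1≤U+V = subst (λ z → ℤ.∣ z ∣ ≤ U + V) (sym split)
                 (ℤ.∣i+j∣≤∣i∣+∣j∣ (ℤ.+ S0 ℤ.- ℤ.+ S1) (ℤ.+ S2 ℤ.- ℤ.+ S1))
    where
    regroup : ∀ a b c → (a ℤ.- ℤ.+ 2 ℤ.* b) ℤ.+ c ≡ (a ℤ.- b) ℤ.+ (c ℤ.- b)
    regroup = solve-∀
    split : twice-k S0 S1 S2 1 ≡ (ℤ.+ S0 ℤ.- ℤ.+ S1) ℤ.+ (ℤ.+ S2 ℤ.- ℤ.+ S1)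
    split = trans (cong (λ w → (ℤ.+ S0 ℤ.- w) ℤ.+ ℤ.+ S2) (ℤ.pos-* 2 S1))
                  (regroup (ℤ.+ S0) (ℤ.+ S1) (ℤ.+ S2))

  t2≤U+V : t 2 ≤ U + V
  t2≤U+V = subst (λ z → ℤ.∣ z ∣ ≤ U + V) (sym (regroup (ℤ.+ S0) (ℤ.+ S1) (ℤ.+ S2)))
                 (ℤ.∣i-j∣≤∣i∣+∣j∣ (ℤ.+ S0 ℤ.- ℤ.+ S1) (ℤ.+ S2 ℤ.- ℤ.+ S1))
    where
    regroup : ∀ a b c → a ℤ.- c ≡ (a ℤ.- b) ℤ.- (c ℤ.- b)
    regroup = solve-∀

  t3≡t2 : t 3 ≡ t 2
  t3≡t2 = trans (cong ℤ.∣_∣ (negate (ℤ.+ S0) (ℤ.+ S2))) (ℤ.∣-i∣≡∣i∣ (ℤ.+ S0 ℤ.- ℤ.+ S2))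
    where
    negate : ∀ a c → ℤ.- a ℤ.+ c ≡ ℤ.- (a ℤ.- c)
    negate = solve-∀

  t4≡2U : t 4 ≡ 2 * U
  t4≡2U = trans (cong₂ (λ x y → ℤ.∣ x ℤ.- y ∣) (ℤ.pos-* 2 S0) (ℤ.pos-* 2 S1))
           (trans (cong ℤ.∣_∣ (factor (ℤ.+ S0) (ℤ.+ S1)))
                  (ℤ.∣i*j∣≡∣i∣*∣j∣ (ℤ.+ 2) (ℤ.+ S0 ℤ.- ℤ.+ S1)))
    where
    factor : ∀ a b → ℤ.+ 2 ℤ.* a ℤ.- ℤ.+ 2 ℤ.* b ≡ ℤ.+ 2 ℤ.* (a ℤ.- b)
    factor = solve-∀

  t5≡2V : t 5 ≡ 2 * V
  t5≡2V = trans (cong₂ (λ x y → ℤ.∣ ℤ.- x ℤ.+ y ∣) (ℤ.pos-* 2 S1) (ℤ.pos-* 2 S2))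
           (trans (cong ℤ.∣_∣ (factor (ℤ.+ S1) (ℤ.+ S2)))
                  (ℤ.∣i*j∣≡∣i∣*∣j∣ (ℤ.+ 2) (ℤ.+ S2 ℤ.- ℤ.+ S1)))
    where
    factor : ∀ b c → ℤ.- (ℤ.+ 2 ℤ.* b) ℤ.+ ℤ.+ 2 ℤ.* c ≡ ℤ.+ 2 ℤ.* (c ℤ.- b)
    factor = solve-∀

  twice-kmax-even : twice-kmax S0 S1 S2 ≡ 2 * (U ⊔ V)
  twice-kmax-even = ≤-antisym upper lower
    where
    D = U ⊔ V
    U+V≤2D : U + V ≤ 2 * D
    U+V≤2D = subst (U + V ≤_) (cong (D +_) (sym (+-identityʳ D)))
                   (+-mono-≤ (m≤m⊔n U V) (m≤n⊔m U V))
    upper : twice-kmax S0 S1 S2 ≤ 2 * D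
    upper = ⊔-lub (⊔-lub (⊔-lub (⊔-lub (⊔-lub
              (≤-trans t1≤U+V U+V≤2D)
              (≤-trans t2≤U+V U+V≤2D))
              (subst (_≤ 2 * D) (sym t3≡t2) (≤-trans t2≤U+V U+V≤2D)))
              (subst (_≤ 2 * D) (sym t4≡2U) (*-monoʳ-≤ 2 (m≤m⊔n U V))))
              (subst (_≤ 2 * D) (sym t5≡2V) (*-monoʳ-≤ 2 (m≤n⊔m U V))))
              z≤n
    t4≤kmax : t 4 ≤ twice-kmax S0 S1 S2
    t4≤kmax = ≤-trans (m≤n⊔m (t 1 ⊔ t 2 ⊔ t 3) (t 4))
                (≤-trans (m≤m⊔n _ (t 5)) (m≤m⊔n _ (t 6)))
    t5≤kmax : t 5 ≤ twice-kmax S0 S1 S2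
    t5≤kmax = ≤-trans (m≤n⊔m (t 1 ⊔ t 2 ⊔ t 3 ⊔ t 4) (t 5)) (m≤m⊔n _ (t 6))
    lower : 2 * D ≤ twice-kmax S0 S1 S2
    lower = subst (_≤ twice-kmax S0 S1 S2) (sym (*-distribˡ-⊔ 2 U V))
              (⊔-lub (subst (_≤ twice-kmax S0 S1 S2) t4≡2U t4≤kmax)
                     (subst (_≤ twice-kmax S0 S1 S2) t5≡2V t5≤kmax))

twice-min≤twice-F : ∀ S0 S1 S2 q → twice-min S0 S1 S2 ≤ twice-F S0 S1 S2 q
twice-min≤twice-F S0 S1 S2 q with fib q
... | zero  = m⊓n≤n (2 * S1) (S0 + S2)
... | suc _ = m⊓n≤m (2 * S1) (S0 + S2)

twice-min-pos : ∀ S0 S1 S2 → 0 < S0 → 0 < S1 → 1 ≤ twice-min S0 S1 S2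
twice-min-pos S0 S1 S2 0<S0 0<S1 =
  ⊓-glb (≤-trans 0<S1 (m≤m+n S1 _)) (≤-trans 0<S0 (m≤m+n S0 S2))

lemma23 : (S0 S1 S2 : ℕ) → 0 < S0 → 0 < S1 → 0 < S2 →
    (n : ℕ) → twice-kmax S0 S1 S2 < 2 * n →
    Σ ℕ (λ i → (1 ≤ i) × InR S0 S1 S2 i n)
lemma23 S0 S1 S2 0<S0 0<S1 _ n 2k<2n = shift (window 1≤m K l (2 * n) 2K≤l*m K≤2n)
  where
  m = twice-min S0 S1 S2
  l = lval S0 S1 S2
  K = twice-kmax S0 S1 S2 + 2
  P = twice-prefix S0 S1 S2
  open Growth P m (λ j → +-monoʳ-≤ (P j) (twice-min≤twice-F S0 S1 S2 (suc j)))
  open Parity S0 S1 S2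

  1≤m : 1 ≤ m
  1≤m = twice-min-pos S0 S1 S2 0<S0 0<S1

  2K≤l*m : 2 * K ≤ l * m
  2K≤l*m = ceilDiv-* (2 * K) m 1≤m

  K≤2n : K ≤ 2 * n
  K≤2n = subst (λ x → x + 2 ≤ 2 * n) (sym twice-kmax-even)
           (double-<⇒+2≤ (U ⊔ V) n (subst (_< 2 * n) twice-kmax-even 2k<2n))

  -- the window starting after the j-th term is R(F[j+1, j+l]).
  shift : (Σ ℕ λ j → (P j + K ≤ 2 * n) × (2 * n + K ≤ P (suc j + l))) →
          Σ ℕ (λ i → (1 ≤ i) × InR S0 S1 S2 i n)
  shift (j , below , covered) = suc j , s≤s z≤n , below , covered
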